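{- There is no positive integer $C$ such that $t(2n+C)=t(2n)$ for every positive integer $n$.
   Context: $t(m)\in\{0,1\}$ is the parity of the number of ones in the binary expansion of $m$. -}

module Defs where

open import Data.Nat using (ℕ; zero; suc; _+_; _/_; _%_)

-- number of ones in the binary expansion of m, computed with fuel k;
-- fuel k ≥ m suffices since m / 2 < m for m > 0.
onesAux : ℕ → ℕ → ℕ
onesAux zero    m = 0
onesAux (suc k) m = m % 2 + onesAux k (m / 2)

ones : ℕ → ℕ
ones m = onesAux m m

t : ℕ → ℕ
t m = ones m % 2

{-# OPTIONS --safe #-}
module Submission where

-- From t(2m) = t(m) and t(2m+1) = 1 − t(m): if C is a period of t on even
-- positions, then C/2 is a period of t when C is even, and (C−1)/2 is an antiperiod
-- (t(m + q) = 1 − t(m)) when C is odd. An antiperiod q yields the period 2q, and the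
-- antiperiod 0 is absurd, so strong induction on C rules out every positive period.

open import Defs
open import Data.Nat using (ℕ; zero; suc; _+_; _*_; _∸_; _≤_; _<_; z≤n; s≤s; z<s; _/_; _%_)
open import Data.Nat.DivMod using (m/n<m; [m+kn]%n≡m%n; m<n⇒m%n≡m; m<n⇒m/n≡0; m*n/n≡m; m%n<n; +-distrib-/-∣ʳ)
open import Data.Nat.Divisibility using (divides-refl)
open import Data.Nat.Induction using (<-rec)
open import Data.Nat.Properties
  using (≤-refl; ≤-trans; ≤-pred; n<1+n; m<m+n; *-suc; *-comm; *-distribˡ-+; m∸[m∸n]≡n)
open import Data.Nat.Tactic.RingSolver using (solve-∀)
open import Data.Product using (Σ-syntax; _,_)
open import Relation.Nullary using (¬_; contradiction)
open import Relation.Binary.PropositionalEquality using (_≡_; refl; sym; trans; cong; cong₂; subst; module ≡-Reasoning)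
open ≡-Reasoning

[1+m]/2≤m : ∀ m → suc m / 2 ≤ m
[1+m]/2≤m m = ≤-pred (m/n<m (suc m) 2 (s≤s (s≤s z≤n)))

onesAux-zero : ∀ k → onesAux k 0 ≡ 0
onesAux-zero zero    = refl
onesAux-zero (suc k) = onesAux-zero k

onesAux-fuel : ∀ {k k′ m} → m ≤ k → m ≤ k′ → onesAux k m ≡ onesAux k′ m
onesAux-fuel {k} {k′} {zero} _ _ = trans (onesAux-zero k) (sym (onesAux-zero k′))
onesAux-fuel {suc k} {suc k′} {suc m} (s≤s m≤k) (s≤s m≤k′) =
  cong (suc m % 2 +_) (onesAux-fuel (≤-trans ([1+m]/2≤m m) m≤k) (≤-trans ([1+m]/2≤m m) m≤k′))

ones-step : ∀ m → ones m ≡ m % 2 + ones (m / 2)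
ones-step zero    = refl
ones-step (suc m) = cong (suc m % 2 +_) (onesAux-fuel ([1+m]/2≤m m) ≤-refl)

ones-bit : ∀ b q → b < 2 → ones (b + q * 2) ≡ b + ones q
ones-bit b q b<2 = begin
  ones (b + q * 2)                         ≡⟨ ones-step (b + q * 2) ⟩
  (b + q * 2) % 2 + ones ((b + q * 2) / 2) ≡⟨ cong₂ _+_ lowBit (cong ones highBits) ⟩
  b + ones q                               ∎
  where
  lowBit : (b + q * 2) % 2 ≡ b
  lowBit = trans ([m+kn]%n≡m%n b q 2) (m<n⇒m%n≡m b<2)
  highBits : (b + q * 2) / 2 ≡ q
  highBits = trans (+-distrib-/-∣ʳ b (divides-refl q)) (cong₂ _+_ (m<n⇒m/n≡0 b<2) (m*n/n≡m q 2))

1+m%2≡1∸m%2 : ∀ m → suc m % 2 ≡ 1 ∸ m % 2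
1+m%2≡1∸m%2 zero          = refl
1+m%2≡1∸m%2 (suc zero)    = refl
1+m%2≡1∸m%2 (suc (suc m)) = 1+m%2≡1∸m%2 m

t-double : ∀ m → t (2 * m) ≡ t m
t-double m = trans (cong t (*-comm 2 m)) (cong (_% 2) (ones-bit 0 m z<s))

t-double+1 : ∀ m → t (suc (2 * m)) ≡ 1 ∸ t m
t-double+1 m = begin
  t (suc (2 * m))     ≡⟨ cong (λ k → t (suc k)) (*-comm 2 m) ⟩
  t (suc (m * 2))     ≡⟨ cong (_% 2) (ones-bit 1 m (s≤s z<s)) ⟩
  suc (ones m) % 2    ≡⟨ 1+m%2≡1∸m%2 (ones m) ⟩
  1 ∸ t m             ∎

1∸[1∸t]≡t : ∀ m → 1 ∸ (1 ∸ t m) ≡ t m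
1∸[1∸t]≡t m = m∸[m∸n]≡n (≤-pred (m%n<n (ones m) 2))

Period : ℕ → Set
Period p = ∀ n → t (suc n + p) ≡ t (suc n)

EvenPeriod : ℕ → Set
EvenPeriod p = ∀ n → t (2 * suc n + p) ≡ t (2 * suc n)

Antiperiod : ℕ → Set
Antiperiod q = ∀ n → 1 ∸ t (suc n + q) ≡ t (suc n)

period⇒evenPeriod : ∀ {p} → Period p → EvenPeriod p
period⇒evenPeriod {p} per n = subst (λ m → t (m + p) ≡ t m) (sym (*-suc 2 n)) (per (suc (2 * n)))

evenPeriod-double⇒period : ∀ {q} → EvenPeriod (2 * q) → Period q
evenPeriod-double⇒period {q} per n = begin
  t (suc n + q)             ≡⟨ sym (t-double (suc n + q)) ⟩
  t (2 * (suc n + q))       ≡⟨ cong t (*-distribˡ-+ 2 (suc n) q) ⟩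
  t (2 * suc n + 2 * q)     ≡⟨ per n ⟩
  t (2 * suc n)             ≡⟨ t-double (suc n) ⟩
  t (suc n)                 ∎

evenPeriod-odd⇒antiperiod : ∀ {q} → EvenPeriod (suc (2 * q)) → Antiperiod q
evenPeriod-odd⇒antiperiod {q} per n = begin
  1 ∸ t (suc n + q)           ≡⟨ sym (t-double+1 (suc n + q)) ⟩
  t (suc (2 * (suc n + q)))   ≡⟨ cong t (regroup n q) ⟩
  t (2 * suc n + suc (2 * q)) ≡⟨ per n ⟩
  t (2 * suc n)               ≡⟨ t-double (suc n) ⟩
  t (suc n)                   ∎
  where
  regroup : ∀ n q → suc (2 * (suc n + q)) ≡ 2 * suc n + suc (2 * q)
  regroup = solve-∀

antiperiod⇒period : ∀ {q} → Antiperiod q → Period (2 * q)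
antiperiod⇒period {q} anti n = begin
  t (suc n + 2 * q)                ≡⟨ cong t (regroup n q) ⟩
  t (suc (n + q) + q)              ≡⟨ sym (1∸[1∸t]≡t (suc (n + q) + q)) ⟩
  1 ∸ (1 ∸ t (suc (n + q) + q))    ≡⟨ cong (1 ∸_) (anti (n + q)) ⟩
  1 ∸ t (suc n + q)                ≡⟨ anti n ⟩
  t (suc n)                        ∎
  where
  regroup : ∀ n q → suc n + 2 * q ≡ suc (n + q) + q
  regroup = solve-∀

¬antiperiod-zero : ¬ Antiperiod 0
¬antiperiod-zero anti = contradiction (anti 0) λ ()

data Halving : ℕ → Set where
  even : ∀ q → Halving (2 * q)
  odd  : ∀ q → Halving (suc (2 * q))

halve : ∀ n → Halving n
halve zero = even 0
halve (suc n) with halve n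
... | even q = odd q
... | odd q  = subst Halving (*-suc 2 q) (even (suc q))

¬evenPeriod : ∀ p → 0 < p → ¬ EvenPeriod p
¬evenPeriod = <-rec (λ p → 0 < p → ¬ EvenPeriod p) step
  where
  step : ∀ p → (∀ {r} → r < p → 0 < r → ¬ EvenPeriod r) → 0 < p → ¬ EvenPeriod p
  step p ih 0<p per with halve p
  step _ _  () per | even zero
  step _ ih _  per | even (suc r) =
    ih (m<m+n (suc r) z<s) z<s (period⇒evenPeriod (evenPeriod-double⇒period {suc r} per))
  step _ _  _  per | odd zero  = ¬antiperiod-zero (evenPeriod-odd⇒antiperiod per)
  step _ ih _  per | odd (suc r) =
    ih (n<1+n _) z<s (period⇒evenPeriod (antiperiod⇒period (evenPeriod-odd⇒antiperiod {suc r} per)))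

lemma9 : ¬ (Σ[ C ∈ ℕ ] ((n : ℕ) → t (2 * suc n + suc C) ≡ t (2 * suc n)))
lemma9 (C , per) = ¬evenPeriod (suc C) z<s per
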